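{- Let $G$ be a connected accessible graph on $[n]$, let $T_1,T_2\in\mathcal C(G)$ with $T_1\not\subset T_2$, and let $W_1$ be a transversal of $G-T_1$ and $W_2$ a transversal of $G-T_2$ with $W_1\subset W_2$. Suppose there exists $f\in T_1\setminus T_2$ whose neighbourhood satisfies $N_G(f)\subset T_1\cup T_2$. Then there exists a cut set $T\subset T_1\cup T_2$ of $G$ such that $T_1\setminus T_2\not\subset T$, $T_2\setminus T_1\not\subset T$, and some transversal of $G-T$ contains $W_1$.
   Context: $G$ is a finite simple graph on $[n]$; $N_G(f)$ is the set of neighbours of $f$. For $S\subset[n]$, $G-S$ is the induced subgraph on $[n]\setminus S$ and $c_G(S)$ its number of connected components; $S$ is a cut set if $c_G(S)>c_G(S\setminus\{i\})$ for all $i\in S$; $\mathcal C(G)$ is the set of cut sets. A transversal of $G-S$ is a set of vertices of $G-S$ meeting each connected component of $G-S$ in exactly one vertex. $G$ is accessible if the binomial edge ideal $J_G\subset K[x_1,\dots,x_n,y_1,\dots,y_n]$ (generated by $x_iy_j-x_jy_i$ for edges $\{i,j\}$, $K$ a field) is unmixed (all minimal primes have the same height; for connected $G$ equivalently $c_G(S)=|S|+1$ for all $S\in\mathcal C(G)$) and every nonempty $S\in\mathcal C(G)$ contains $s$ with $S\setminus\{s\}\in\mathcal C(G)$. -}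

module Defs where

open import Data.Nat using (ℕ; suc; _<_)
open import Data.Fin using (Fin)
open import Data.Fin.Subset using (Subset; _∈_; _∉_; _⊆_; _-_; ∣_∣; Nonempty)
open import Data.Product using (Σ; ∃; _×_)
open import Relation.Nullary using (¬_)
open import Relation.Binary.Definitions using (Decidable)
open import Relation.Binary.PropositionalEquality using (_≡_)
open import Relation.Binary.Construct.Closure.ReflexiveTransitive using (Star)

record Graph (n : ℕ) : Set₁ where
  field
    Adj   : Fin n → Fin n → Set
    adj?  : Decidable Adj
    sym   : ∀ {u v} → Adj u v → Adj v u
    irrefl : ∀ {u} → ¬ Adj u u

open Graph public

module _ {n : ℕ} (G : Graph n) where

  Step : Subset n → Fin n → Fin n → Set
  Step S u v = u ∉ S × v ∉ S × Adj G u v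

  Conn : Subset n → Fin n → Fin n → Set
  Conn S u v = u ∉ S × Star (Step S) u v

  Connected : Set
  Connected = ∀ u v → Star (Adj G) u v

  NbhdSub : Fin n → Subset n → Set
  NbhdSub f A = ∀ v → Adj G f v → v ∈ A

  -- c_G(S) = k : G - S has exactly k connected components, witnessed by
  -- k representatives, pairwise in distinct components, covering all components.
  NumComp : Subset n → ℕ → Set
  NumComp S k =
    Σ (Fin k → Fin n) λ r →
      (∀ i → r i ∉ S) ×
      (∀ i j → Conn S (r i) (r j) → i ≡ j) ×
      (∀ v → v ∉ S → ∃ λ i → Conn S v (r i))

  CutSet : Subset n → Set
  CutSet S = ∀ i → i ∈ S → ∀ k k' → NumComp S k → NumComp (S - i) k' → k' < k

  Transversal : Subset n → Subset n → Set
  Transversal S W =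
    (∀ w → w ∈ W → w ∉ S) ×
    (∀ v → v ∉ S → ∃ λ w → w ∈ W × Conn S v w) ×
    (∀ w w' → w ∈ W → w' ∈ W → Conn S w w' → w ≡ w')

  -- Unmixedness of J_G for connected G: c_G(S) = |S| + 1 for every cut set S
  Unmixed : Set
  Unmixed = ∀ S → CutSet S → NumComp S (suc ∣ S ∣)

  Accessible : Set
  Accessible = Unmixed × (∀ S → CutSet S → Nonempty S → ∃ λ s → s ∈ S × CutSet (S - s))

{-# OPTIONS --safe #-}
-- Some g lies in T₂ ∖ T₁: otherwise every neighbour of f lies in T₁, f becomes an isolated
-- vertex once it is removed from T₁, and c(T₁ ∖ {f}) = c(T₁) + 1 contradicts T₁ being a cut set.
-- Put U = (T₁ ∪ T₂) ∖ {f, g}. The only neighbour of f outside U is g, so every walk in G - U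
-- between vertices of W₁ can be shortcut to a walk in G - T₁; hence W₁ still meets distinct
-- components of G - U. A minimal T ⊆ U with this property is a cut set, since re-inserting any
-- i ∈ T joins two components of G - T through i. Finally W₁ extends to a transversal of G - T by
-- adding one vertex from each component that W₁ misses.
module Submission where

open import Defs renaming (sym to adj-sym)
open import Data.Nat using (ℕ; suc; s≤s)
import Data.Nat as ℕ
open import Data.Nat.Properties using (<-asym; n<1+n)
open import Data.Fin using (Fin; zero; suc; _<_; punchOut)
open import Data.Fin.Properties
  using (_≟_; _<?_; any?; all?; <-cmp; injective⇒≤; punchOut-injective)
open import Data.Fin.Subset
  using (Subset; _∈_; _∉_; _⊆_; _⊈_; _∪_; _─_; _-_; ⁅_⁆; _⊂_; _⊃_; inside; outside)
open import Data.Fin.Subset.Properties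
  using ( _∈?_; nonempty?; x∈p∪q⁺; x∈p∪q⁻; x∈⁅x⁆; x∈⁅y⁆⇒x≡y; x∈p∧x∉q⇒x∈p─q; x∈p∧x≢y⇒x∈p-y
        ; p─q⊆p; p⊆p∪q; x∈p⇒p-x⊂p)
open import Data.Fin.Subset.Induction using (Acc; acc; ⊃-wellFounded; ⊂-wellFounded)
open import Data.Vec.Base using (_∷_; tabulate; there)
open import Data.Vec.Properties using ([]=⇒lookup; lookup⇒[]=; lookup∘tabulate)
open import Data.Product using (∃; _×_; _,_; proj₁; proj₂)
open import Data.Sum using (_⊎_; inj₁; inj₂)
open import Data.Empty using (⊥-elim)
open import Function using (_∘_; id; Injective)
open import Relation.Binary.Definitions
  using (tri<; tri≈; tri>) renaming (Decidable to Decidable₂)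
open import Relation.Binary.PropositionalEquality using (_≡_; _≢_; refl; sym; trans; cong; subst)
open import Relation.Binary.Construct.Closure.ReflexiveTransitive
  using (Star; ε; _◅_; _◅◅_; reverse)
import Relation.Binary.Construct.Closure.ReflexiveTransitive as Star
open import Relation.Nullary using (¬_; Dec; yes; no; does)
open import Relation.Nullary.Decidable
  using (_×-dec_; _⊎-dec_; _→-dec_; ¬?; dec-true; decidable-stable)
open import Relation.Unary using (Pred; Decidable)

private
  variable
    n k k' : ℕ
    S T W T₁ T₂ W₁ W₂ : Subset n
    p q : Subset n
    u v x y z i f g : Fin n

x∈p─q⇒x∉q : x ∈ p ─ q → x ∉ q
x∈p─q⇒x∉q {p = _ ∷ _} {outside ∷ _} (there x∈) (there x∈q) = x∈p─q⇒x∉q x∈ x∈q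
x∈p─q⇒x∉q {p = _ ∷ _} {inside ∷ _} (there x∈) (there x∈q) = x∈p─q⇒x∉q x∈ x∈q

x∉p-y∧x≢y⇒x∉p : x ∉ p - y → x ≢ y → x ∉ p
x∉p-y∧x≢y⇒x∉p x∉ x≢y x∈ = x∉ (x∈p∧x≢y⇒x∈p-y x∈ x≢y)

x∉p⇒x∉p-y : x ∉ p → x ∉ p - y
x∉p⇒x∉p-y {p = p} x∉ = x∉ ∘ p─q⊆p p _

x∉p-x : x ∉ p - x
x∉p-x {x = x} x∈ = x∈p─q⇒x∉q x∈ (x∈⁅x⁆ x)

p∪⁅x⁆-x⊆p : (p ∪ ⁅ x ⁆) - x ⊆ p
p∪⁅x⁆-x⊆p {p = p} y∈ with x∈p∪q⁻ p _ (p─q⊆p _ _ y∈)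
... | inj₁ y∈p = y∈p
... | inj₂ y∈⁅x⁆ = ⊥-elim (x∈p─q⇒x∉q y∈ y∈⁅x⁆)

x∉p∧x≢y⇒x∉p∪⁅y⁆ : x ∉ p → x ≢ y → x ∉ p ∪ ⁅ y ⁆
x∉p∧x≢y⇒x∉p∪⁅y⁆ {p = p} x∉p x≢y x∈ with x∈p∪q⁻ p _ x∈
... | inj₁ x∈p = x∉p x∈p
... | inj₂ x∈⁅y⁆ = x≢y (x∈⁅y⁆⇒x≡y _ x∈⁅y⁆)

x∉p⇒p⊂p∪⁅x⁆ : x ∉ p → p ⊂ p ∪ ⁅ x ⁆
x∉p⇒p⊂p∪⁅x⁆ {x = x} x∉p = p⊆p∪q _ , x , x∈p∪q⁺ (inj₂ (x∈⁅x⁆ x)) , x∉p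

x∈p∧x∉p-y-z∧x≢y⇒x≡z : x ∈ p → x ∉ p - y - z → x ≢ y → x ≡ z
x∈p∧x∉p-y-z∧x≢y⇒x≡z x∈p x∉ x≢y =
  decidable-stable (_ ≟ _) (x∉ ∘ x∈p∧x≢y⇒x∈p-y (x∈p∧x≢y⇒x∈p-y x∈p x≢y))

module _ {ℓ} {P : Pred (Fin n) ℓ} (P? : Decidable P) where

  select : Subset n
  select = tabulate (does ∘ P?)

  ∈-select⁺ : ∀ {v} → P v → v ∈ select
  ∈-select⁺ {v} pv = lookup⇒[]= v select (trans (lookup∘tabulate _ v) (dec-true (P? v) pv))

  ∈-select⁻ : ∀ {v} → v ∈ select → P v
  ∈-select⁻ {v} v∈ with P? v | trans (sym (lookup∘tabulate (does ∘ P?) v)) ([]=⇒lookup v∈)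
  ... | yes pv | _ = pv
  ... | no _   | ()

least : ∀ {ℓ} {P : Pred (Fin n) ℓ} → Decidable P → ∀ {v} → P v →
        ∃ λ u → P u × (∀ u' → u' < u → ¬ P u')
least P? {zero} pv = zero , pv , λ _ ()
least P? {suc v} pv with P? zero
... | yes p0 = zero , p0 , λ _ ()
... | no ¬p0 with least (P? ∘ suc) pv
...   | u , pu , below = suc u , pu , λ { zero _ → ¬p0 ; (suc u') (s≤s u'<u) → below u' u'<u }

surjection-with-collision⇒< : (h : Fin k → Fin k') → (∀ j → ∃ λ c → h c ≡ j) →
                              ∀ {a b} → a ≢ b → h a ≡ h b → k' ℕ.< k
surjection-with-collision⇒< {suc k} {k'} h surj {a} {b} a≢b ha≡hb =
  s≤s (injective⇒≤ punched-injective)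
  where
  section : Fin k' → Fin (suc k)
  section j = proj₁ (surj j)

  section-injective : Injective _≡_ _≡_ section
  section-injective {i} {j} eq = trans (sym (proj₂ (surj i))) (trans (cong h eq) (proj₂ (surj j)))

  hit-at-h-a : ∀ {j e} → section j ≡ e → h e ≡ h a → section (h a) ≡ e
  hit-at-h-a {j} refl he = cong section (trans (sym he) (proj₂ (surj j)))

  -- a and b have the same image, so the section can hit at most one of them
  missed : ∃ λ e → ∀ j → section j ≢ e
  missed with section (h a) ≟ a
  ... | yes sa≡a = b , λ j sj≡b → a≢b (trans (sym sa≡a) (hit-at-h-a sj≡b (sym ha≡hb)))
  ... | no sa≢a = a , λ j sj≡a → sa≢a (hit-at-h-a sj≡a refl)

  missed≢section : ∀ j → proj₁ missed ≢ section j
  missed≢section j = proj₂ missed j ∘ sym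

  punched : Fin k' → Fin k
  punched j = punchOut (missed≢section j)

  punched-injective : Injective _≡_ _≡_ punched
  punched-injective {i} {j} =
    section-injective ∘ punchOut-injective (missed≢section i) (missed≢section j)

module _ (G : Graph n) where

  Walk : Subset n → Fin n → Fin n → Set
  Walk S = Star (Step G S)

  step? : ∀ S → Decidable₂ (Step G S)
  step? S u v = ¬? (u ∈? S) ×-dec (¬? (v ∈? S) ×-dec adj? G u v)

  step-sym : Step G S u v → Step G S v u
  step-sym (u∉ , v∉ , uv) = v∉ , u∉ , adj-sym G uv

  walk-reverse : Walk S u v → Walk S v u
  walk-reverse = reverse step-sym

  walk-antimono : ∀ {S S'} → S' ⊆ S → Walk S u v → Walk S' u v
  walk-antimono S'⊆S = Star.map λ (u∉ , v∉ , uv) → u∉ ∘ S'⊆S , v∉ ∘ S'⊆S , uv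

  walk-end∉ : u ∉ S → Walk S u v → v ∉ S
  walk-end∉ u∉ ε = u∉
  walk-end∉ _ ((_ , w∉ , _) ◅ p) = walk-end∉ w∉ p

  walk-avoids⊎enters : x ∉ T → Walk (T - i) x y →
                       Walk T x y ⊎ ∃ λ u → Walk T x u × u ∉ T × Adj G u i
  walk-avoids⊎enters x∉ ε = inj₁ ε
  walk-avoids⊎enters {x = x} {i = i} x∉ (_◅_ {j = z} (_ , z∉ , xz) p) with z ≟ i
  ... | yes refl = inj₂ (x , ε , x∉ , xz)
  ... | no z≢i with walk-avoids⊎enters (x∉p-y∧x≢y⇒x∉p z∉ z≢i) p
  ...   | inj₁ q = inj₁ ((x∉ , x∉p-y∧x≢y⇒x∉p z∉ z≢i , xz) ◅ q)
  ...   | inj₂ (u , q , u∉ , ui) = inj₂ (u , (x∉ , x∉p-y∧x≢y⇒x∉p z∉ z≢i , xz) ◅ q , u∉ , ui)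

  walk-last-exit : u ∉ S → u ≢ v → Walk S u v → ∃ λ w → Step G S u w × Walk (S ∪ ⁅ u ⁆) w v
  walk-last-exit {u = u} u∉ u≢v p with x∉p∧x≢y⇒x∉p∪⁅y⁆ (walk-end∉ u∉ p) (u≢v ∘ sym)
  ... | v∉ with walk-avoids⊎enters v∉ (walk-antimono p∪⁅x⁆-x⊆p (walk-reverse p))
  ...   | inj₁ q = ⊥-elim (walk-end∉ v∉ q (x∈p∪q⁺ (inj₂ (x∈⁅x⁆ u))))
  ...   | inj₂ (w , q , w∉ , wu) = w , (u∉ , w∉ ∘ p⊆p∪q _ , adj-sym G wu) , walk-reverse q

  walk? : ∀ S u v → Dec (Walk S u v)
  walk? S = go S (⊃-wellFounded S)
    where
    -- a walk from u never has to return to u, so u is deleted for the rest of the search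
    go : ∀ S → Acc _⊃_ S → ∀ u v → Dec (Walk S u v)
    go S (acc rs) u v with u ≟ v | u ∈? S
    ... | yes refl | _ = yes ε
    ... | no u≢v | yes u∈S = no λ { ε → u≢v refl ; ((u∉ , _) ◅ _) → u∉ u∈S }
    ... | no u≢v | no u∉S
      with any? (λ w → step? S u w ×-dec go (S ∪ ⁅ u ⁆) (rs (x∉p⇒p⊂p∪⁅x⁆ u∉S)) w v)
    ...   | yes (w , uw , p) = yes (uw ◅ walk-antimono (p⊆p∪q _) p)
    ...   | no ¬exit = no (¬exit ∘ walk-last-exit u∉S u≢v)

  numComp-remove-enclosed : f ∈ T → NbhdSub G f T → NumComp G T k → NumComp G (T - f) (suc k)
  numComp-remove-enclosed {f = f} {T = T} {k = k} f∈T enclosed (r , r∉ , r-distinct , r-cover) =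
    r' , r'∉ , distinct , cover
    where
    confined : x ∉ T → Walk (T - f) x y → Walk T x y
    confined x∉ p with walk-avoids⊎enters x∉ p
    ... | inj₁ q = q
    ... | inj₂ (u , _ , u∉ , uf) = ⊥-elim (u∉ (enclosed u (adj-sym G uf)))

    ¬reaches-f : ∀ c → ¬ Walk (T - f) (r c) f
    ¬reaches-f c p = walk-end∉ (r∉ c) (confined (r∉ c) p) f∈T

    r' : Fin (suc k) → Fin n
    r' zero = f
    r' (suc c) = r c

    r'∉ : ∀ c → r' c ∉ T - f
    r'∉ zero = x∉p-x
    r'∉ (suc c) = x∉p⇒x∉p-y (r∉ c)

    distinct : ∀ c d → Conn G (T - f) (r' c) (r' d) → c ≡ d
    distinct zero zero _ = refl
    distinct zero (suc d) (_ , p) = ⊥-elim (¬reaches-f d (walk-reverse p))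
    distinct (suc c) zero (_ , p) = ⊥-elim (¬reaches-f c p)
    distinct (suc c) (suc d) (_ , p) = cong suc (r-distinct c d (r∉ c , confined (r∉ c) p))

    cover : ∀ v → v ∉ T - f → ∃ λ c → Conn G (T - f) v (r' c)
    cover v v∉ with v ≟ f
    ... | yes refl = zero , v∉ , ε
    ... | no v≢f with r-cover v (x∉p-y∧x≢y⇒x∉p v∉ v≢f)
    ...   | c , _ , p = suc c , v∉ , walk-antimono (p─q⊆p T _) p

  cutSet-vertex-not-enclosed : CutSet G T → NumComp G T k → f ∈ T → ¬ NbhdSub G f T
  cutSet-vertex-not-enclosed {k = k} cut nc f∈T enclosed =
    <-asym (n<1+n k) (cut _ f∈T k (suc k) nc (numComp-remove-enclosed f∈T enclosed nc))

  joining-neighbours⇒fewer-components :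
    u ∉ T → v ∉ T → Adj G u i → Adj G v i → ¬ Walk T u v →
    NumComp G T k → NumComp G (T - i) k' → k' ℕ.< k
  joining-neighbours⇒fewer-components {u = u} {T = T} {v = v} {i = i} u∉ v∉ ui vi ¬uv
    (r , r∉ , _ , r-cover) (r' , r'∉ , r'-distinct , r'-cover) =
    surjection-with-collision⇒< component surjective a≢b merged
    where
    lift : Walk T x y → Walk (T - i) x y
    lift = walk-antimono (p─q⊆p T _)

    same : ∀ {j j'} → Walk (T - i) (r' j) (r' j') → j ≡ j'
    same {j} p = r'-distinct j _ (r'∉ j , p)

    home : ∀ c → ∃ λ j → Conn G (T - i) (r c) (r' j)
    home c = r'-cover (r c) (x∉p⇒x∉p-y (r∉ c))

    component : Fin _ → Fin _
    component c = proj₁ (home c)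

    from-home : ∀ c → Walk (T - i) (r' (component c)) (r c)
    from-home c = walk-reverse (proj₂ (proj₂ (home c)))

    a = proj₁ (r-cover u u∉)
    b = proj₁ (r-cover v v∉)

    a→u : Walk T (r a) u
    a→u = walk-reverse (proj₂ (proj₂ (r-cover u u∉)))

    v→b : Walk T v (r b)
    v→b = proj₂ (proj₂ (r-cover v v∉))

    a≢b : a ≢ b
    a≢b a≡b = ¬uv (walk-reverse a→u ◅◅ walk-reverse (subst (Walk T v ∘ r) (sym a≡b) v→b))

    u-i : Step G (T - i) u i
    u-i = x∉p⇒x∉p-y u∉ , x∉p-x , ui

    i-v : Step G (T - i) i v
    i-v = step-sym (x∉p⇒x∉p-y v∉ , x∉p-x , vi)

    merged : component a ≡ component b
    merged = same (from-home a ◅◅ lift a→u ◅◅ u-i ◅ i-v ◅ lift v→b ◅◅ walk-reverse (from-home b))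

    surjective : ∀ j → ∃ λ c → component c ≡ j
    surjective j with r' j ≟ i
    ... | yes r'j≡i =
      a , same (subst (Walk (T - i) _) (sym r'j≡i) (from-home a ◅◅ lift a→u ◅◅ u-i ◅ ε))
    ... | no r'j≢i with r-cover (r' j) (x∉p-y∧x≢y⇒x∉p (r'∉ j) r'j≢i)
    ...   | c , _ , p = c , same (from-home c ◅◅ lift (walk-reverse p))

  Links : Subset n → Subset n → Set
  Links S W = ∃ λ w → ∃ λ w' → w ∈ W × w' ∈ W × w ≢ w' × Walk S w w'

  links? : ∀ S W → Dec (Links S W)
  links? S W = any? λ w → any? λ w' →
    w ∈? W ×-dec (w' ∈? W ×-dec (¬? (w ≟ w') ×-dec walk? S w w'))

  Separates : Subset n → Subset n → Set
  Separates S W = (∀ w → w ∈ W → w ∉ S) × ¬ Links S W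

  transversal⇒separates : Transversal G S W → Separates S W
  transversal⇒separates (W∩S , _ , unique) =
    W∩S , λ (w , w' , w∈ , w'∈ , w≢w' , p) → w≢w' (unique w w' w∈ w'∈ (W∩S w w∈ , p))

  minimal-separator⇒cutSet : Separates T W → (∀ i → i ∈ T → Links (T - i) W) → CutSet G T
  minimal-separator⇒cutSet (W∩T , ¬links) minimal i i∈T _ _ with minimal i i∈T
  ... | w , w' , w∈ , w'∈ , w≢w' , p
    with walk-avoids⊎enters (W∩T w w∈) p | walk-avoids⊎enters (W∩T w' w'∈) (walk-reverse p)
  ... | inj₁ q | _ = ⊥-elim (¬links (w , w' , w∈ , w'∈ , w≢w' , q))
  ... | inj₂ _ | inj₁ q = ⊥-elim (¬links (w' , w , w'∈ , w∈ , w≢w' ∘ sym , q))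
  ... | inj₂ (u , w→u , u∉ , ui) | inj₂ (u' , w'→u' , u'∉ , u'i) =
    joining-neighbours⇒fewer-components u∉ u'∉ ui u'i
      (λ u→u' → ¬links (w , w' , w∈ , w'∈ , w≢w' , w→u ◅◅ u→u' ◅◅ walk-reverse w'→u'))

  separator⇒cutSet-inside : Separates S W → ∃ λ T → T ⊆ S × CutSet G T × Separates T W
  separator⇒cutSet-inside = go (⊂-wellFounded _)
    where
    go : Acc _⊂_ S → Separates S W → ∃ λ T → T ⊆ S × CutSet G T × Separates T W
    go {S = S} {W = W} (acc rs) (W∩S , ¬links)
      with any? (λ i → i ∈? S ×-dec ¬? (links? (S - i) W))
    ... | yes (i , i∈S , ¬links')
      with go (rs (x∈p⇒p-x⊂p i∈S)) ((λ w w∈ → x∉p⇒x∉p-y (W∩S w w∈)) , ¬links')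
    ...   | T , T⊆ , cut , sep = T , p─q⊆p S _ ∘ T⊆ , cut , sep
    go {S = S} {W = W} (acc rs) (W∩S , ¬links) | no ¬shrinkable =
      S , id , minimal-separator⇒cutSet (W∩S , ¬links) minimal , W∩S , ¬links
      where
      minimal : ∀ i → i ∈ S → Links (S - i) W
      minimal i i∈S =
        decidable-stable (links? (S - i) W) λ ¬links' → ¬shrinkable (i , i∈S , ¬links')

  separator⇒transversal-extending : Separates T W → ∃ λ W' → Transversal G T W' × W ⊆ W'
  separator⇒transversal-extending {T = T} {W = W} (W∩T , ¬links) =
    select Rep? , (W'∩T , cover , unique) , ∈-select⁺ Rep? ∘ inj₁
    where
    Unreached : Fin n → Set
    Unreached v = ∀ w → w ∈ W → ¬ Walk T v w

    -- components of G - T that miss W are represented by their least vertex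
    Rep : Fin n → Set
    Rep v = v ∈ W ⊎ (v ∉ T × Unreached v × (∀ u → u < v → ¬ Walk T v u))

    Rep? : Decidable Rep
    Rep? v = v ∈? W ⊎-dec (¬? (v ∈? T) ×-dec
      (all? (λ w → w ∈? W →-dec ¬? (walk? T v w)) ×-dec
       all? (λ u → u <? v →-dec ¬? (walk? T v u))))

    W'∩T : ∀ w → w ∈ select Rep? → w ∉ T
    W'∩T w w∈ with ∈-select⁻ Rep? w∈
    ... | inj₁ w∈W = W∩T w w∈W
    ... | inj₂ (w∉ , _) = w∉

    cover : ∀ v → v ∉ T → ∃ λ w → w ∈ select Rep? × Conn G T v w
    cover v v∉ with any? (λ w → w ∈? W ×-dec walk? T v w)
    ... | yes (w , w∈ , p) = w , ∈-select⁺ Rep? (inj₁ w∈) , v∉ , p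
    ... | no ¬reached with least (walk? T v) ε
    ...   | u , p , below =
      u , ∈-select⁺ Rep? (inj₂ (walk-end∉ v∉ p , (λ w w∈ q → ¬reached (w , w∈ , p ◅◅ q)) ,
                                λ u' u'<u q → below u' u'<u (p ◅◅ q))) ,
      v∉ , p

    unique : ∀ w w' → w ∈ select Rep? → w' ∈ select Rep? → Conn G T w w' → w ≡ w'
    unique w w' w∈ w'∈ (_ , p) = both (∈-select⁻ Rep? w∈) (∈-select⁻ Rep? w'∈)
      where
      both : Rep w → Rep w' → w ≡ w'
      both (inj₁ w∈W) (inj₁ w'∈W) =
        decidable-stable (w ≟ w') λ w≢w' → ¬links (w , w' , w∈W , w'∈W , w≢w' , p)
      both (inj₁ w∈W) (inj₂ (_ , unreached , _)) = ⊥-elim (unreached w w∈W (walk-reverse p))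
      both (inj₂ (_ , unreached , _)) (inj₁ w'∈W) = ⊥-elim (unreached w' w'∈W p)
      both (inj₂ (_ , _ , least-w)) (inj₂ (_ , _ , least-w')) with <-cmp w w'
      ... | tri< w<w' _ _ = ⊥-elim (least-w' w w<w' (walk-reverse p))
      ... | tri≈ _ w≡w' _ = w≡w'
      ... | tri> _ _ w'<w = ⊥-elim (least-w w' w'<w p)

  -- f has no neighbour outside S other than g, so a walk through f enters and leaves it via g
  walk-shortcut : (∀ z → z ∉ S → z ≢ f → z ∉ T) → (∀ y → Adj G f y → y ∉ S → y ≡ g) →
                  x ≢ f → y ≢ f → Walk S x y → Walk T x y
  walk-shortcut _ _ _ _ ε = ε
  walk-shortcut {f = f} {x = x} T⊆S∪f pendant x≢f y≢f (_◅_ {j = z} (x∉ , z∉ , xz) p) with z ≟ f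
  ... | no z≢f = (T⊆S∪f x x∉ x≢f , T⊆S∪f z z∉ z≢f , xz) ◅ walk-shortcut T⊆S∪f pendant z≢f y≢f p
  ... | yes refl with p
  ...   | ε = ⊥-elim (y≢f refl)
  ...   | (_ , z'∉ , fz') ◅ p' =
    subst (λ s → Walk _ s _) (trans (pendant _ fz' z'∉) (sym (pendant x (adj-sym G xz) x∉)))
      (walk-shortcut T⊆S∪f pendant (λ { refl → irrefl G fz' }) y≢f p')

  separates-shortcut : Separates T W → (∀ w → w ∈ W → w ∉ S) → f ∈ T →
                       (∀ z → z ∉ S → z ≢ f → z ∉ T) → (∀ y → Adj G f y → y ∉ S → y ≡ g) →
                       Separates S W
  separates-shortcut {W = W} {f = f} (W∩T , ¬links) W∩S f∈T T⊆S∪f pendant =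
    W∩S , λ (w , w' , w∈ , w'∈ , w≢w' , p) →
      ¬links (w , w' , w∈ , w'∈ , w≢w' , walk-shortcut T⊆S∪f pendant (≢f w∈) (≢f w'∈) p)
    where
    ≢f : ∀ {w} → w ∈ W → w ≢ f
    ≢f w∈ refl = W∩T _ w∈ f∈T

  cutSet-avoiding-pair : Transversal G T₁ W₁ → Transversal G T₂ W₂ → W₁ ⊆ W₂ →
                         f ∈ T₁ → g ∉ T₁ → NbhdSub G f (T₁ ∪ T₂) →
                         ∃ λ T → T ⊆ (T₁ ∪ T₂) - f - g × CutSet G T ×
                                 ∃ λ W → Transversal G T W × W₁ ⊆ W
  cutSet-avoiding-pair {T₁ = T₁} {W₁ = W₁} {T₂ = T₂} {f = f} {g = g}
                       tr₁ tr₂ W₁⊆W₂ f∈T₁ g∉T₁ N[f]⊆ =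
    let T , T⊆U , cut , sepT = separator⇒cutSet-inside sepU
    in T , T⊆U , cut , separator⇒transversal-extending sepT
    where
    U : Subset _
    U = (T₁ ∪ T₂) - f - g

    W₁∩U : ∀ w → w ∈ W₁ → w ∉ U
    W₁∩U w w∈ w∈U with x∈p∪q⁻ T₁ T₂ (p─q⊆p _ _ (p─q⊆p _ _ w∈U))
    ... | inj₁ w∈T₁ = proj₁ tr₁ w w∈ w∈T₁
    ... | inj₂ w∈T₂ = proj₁ tr₂ w (W₁⊆W₂ w∈) w∈T₂

    T₁⊆U∪f : ∀ z → z ∉ U → z ≢ f → z ∉ T₁
    T₁⊆U∪f z z∉ z≢f z∈T₁ with x∈p∧x∉p-y-z∧x≢y⇒x≡z (x∈p∪q⁺ (inj₁ z∈T₁)) z∉ z≢f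
    ... | refl = g∉T₁ z∈T₁

    pendant : ∀ y → Adj G f y → y ∉ U → y ≡ g
    pendant y fy y∉ = x∈p∧x∉p-y-z∧x≢y⇒x≡z (N[f]⊆ y fy) y∉ λ { refl → irrefl G fy }

    sepU : Separates U W₁
    sepU = separates-shortcut (transversal⇒separates tr₁) W₁∩U f∈T₁ T₁⊆U∪f pendant

lemma4p5 : ∀ {n : ℕ} (G : Graph n) → Connected G → Accessible G →
    ∀ (T₁ T₂ W₁ W₂ : Subset n) →
    CutSet G T₁ → CutSet G T₂ → T₁ ⊈ T₂ →
    Transversal G T₁ W₁ → Transversal G T₂ W₂ → W₁ ⊆ W₂ →
    (∃ λ f → f ∈ (T₁ ─ T₂) × NbhdSub G f (T₁ ∪ T₂)) →
    ∃ λ T → CutSet G T × T ⊆ (T₁ ∪ T₂) × (T₁ ─ T₂) ⊈ T × (T₂ ─ T₁) ⊈ T ×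
      (∃ λ W → Transversal G T W × W₁ ⊆ W)
lemma4p5 G _ (unmixed , _) T₁ T₂ W₁ W₂ cut₁ _ _ tr₁ tr₂ W₁⊆W₂ (f , f∈T₁─T₂ , N[f]⊆)
  with nonempty? (T₂ ─ T₁)
... | no T₂─T₁-empty =
  ⊥-elim (cutSet-vertex-not-enclosed G cut₁ (unmixed T₁ cut₁) (p─q⊆p T₁ T₂ f∈T₁─T₂) N[f]⊆T₁)
  where
  N[f]⊆T₁ : NbhdSub G f T₁
  N[f]⊆T₁ v fv with x∈p∪q⁻ T₁ T₂ (N[f]⊆ v fv)
  ... | inj₁ v∈T₁ = v∈T₁
  ... | inj₂ v∈T₂ =
    decidable-stable (v ∈? T₁) λ v∉T₁ → T₂─T₁-empty (v , x∈p∧x∉q⇒x∈p─q v∈T₂ v∉T₁)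
... | yes (g , g∈T₂─T₁)
  with cutSet-avoiding-pair G tr₁ tr₂ W₁⊆W₂ (p─q⊆p T₁ T₂ f∈T₁─T₂) (x∈p─q⇒x∉q g∈T₂─T₁) N[f]⊆
...   | T , T⊆U , cut , extension =
  T , cut , p─q⊆p _ _ ∘ p─q⊆p _ _ ∘ T⊆U ,
  (λ ⊆T → x∉p-x (p─q⊆p _ _ (T⊆U (⊆T f∈T₁─T₂)))) ,
  (λ ⊆T → x∉p-x (T⊆U (⊆T g∈T₂─T₁))) ,
  extension
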